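{- Let $\mathbf{C}:\mathcal{C}\to\mathcal{B}$ be a Grothendieck fibration, and let $g:C\to D$ and $k:B\to D$ be morphisms in $\mathcal{B}$. If, for each object $Q$ in the fiber $\mathbf{C}^B$, there is a $\prod$-diagram over $k$ based on $Q$ that is stable along $g$, then every cocartesian lift of $g$ is stable along $k$.
   Context: Terminology (for a fibration $\mathbf{C}:\mathcal{C}\to\mathcal{B}$; $\mathbf{C}^X$ denotes the fiber over $X\in\mathcal{B}$): A $\prod$-diagram over a morphism $u:X\to Y$ of $\mathcal{B}$ based on $P\in\mathbf{C}^X$ consists of a cartesian morphism $u^*\prod_uP\to\prod_uP$ over $u$ together with a morphism $\varepsilon:u^*\prod_uP\to P$ over $X$. It is required to have the following universal property. For every cartesian morphism $u^*R\to R$ over $u$ and every morphism $p:u^*R\to P$ over $X$, there is a unique $\tilde p:R\to\prod_uP$ over $Y$ such that $\varepsilon\circ u^*\tilde p=p$. Here $u^*\tilde p$ is the induced morphism between the domains of the cartesian lifts. For the pullback square in $\mathcal{B}$ formed by $f:A\to B$, $h:A\to C$, $k:B\to D$ and $g:C\to D$ (so $kf=gh$), stability is defined as follows. (a) A $\prod$-diagram over $k$ based on $Q\in\mathbf{C}^B$, say $\varepsilon:k^*\prod_kQ\to Q$, is stable along $g$ if the following holds for every such pullback square. Choose cartesian lifts $f^*k^*\prod_kQ\to k^*\prod_kQ$, $f^*Q\to Q$ and $g^*\prod_kQ\to\prod_kQ$. Then the induced morphism $f^*k^*\prod_kQ\to g^*\prod_kQ$ over $h$, together with $f^*\varepsilon:f^*k^*\prod_kQ\to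 f^*Q$, is a $\prod$-diagram over $h$ (this is the Beck–Chevalley condition). (b) A cocartesian lift $P\to\sum_gP$ of $g$ (with $P\in\mathbf{C}^C$) is stable along $k$ if the following holds for every such pullback square. Choose cartesian lifts $h^*P\to P$ over $h$ and $k^*\sum_gP\to\sum_gP$ over $k$. Then the induced morphism $h^*P\to k^*\sum_gP$ over $f$ is cocartesian. -}

module Defs where

open import Level using (Level; _⊔_; suc)
open import Data.Product using (Σ; _×_; _,_)
open import Relation.Binary.PropositionalEquality using (_≡_; subst; sym; trans)

Unique : ∀ {a p} {A : Set a} → (A → Set p) → Set (a ⊔ p)
Unique {A = A} P = Σ A λ x → P x × (∀ y → P y → x ≡ y)

record Category (o ℓ : Level) : Set (suc (o ⊔ ℓ)) where
  infixr 9 _∘_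
  field
    Obj : Set o
    Hom : Obj → Obj → Set ℓ
    id  : ∀ {X} → Hom X X
    _∘_ : ∀ {X Y Z} → Hom Y Z → Hom X Y → Hom X Z
    identityˡ : ∀ {X Y} {f : Hom X Y} → id ∘ f ≡ f
    identityʳ : ∀ {X Y} {f : Hom X Y} → f ∘ id ≡ f
    assoc : ∀ {W X Y Z} {f : Hom W X} {g : Hom X Y} {h : Hom Y Z} →
            (h ∘ g) ∘ f ≡ h ∘ (g ∘ f)
    Hom-isSet : ∀ {X Y} {f g : Hom X Y} (p q : f ≡ g) → p ≡ q

-- A functor C : 𝒞 → ℬ presented as a category displayed over ℬ:
-- Ob[ X ] is the fiber 𝐂^X, and Hom[ u ] E E' are the morphisms E → E' of 𝒞 lying over u.
record Displayed {o ℓ} (𝓑 : Category o ℓ) (o' ℓ' : Level) : Set (o ⊔ ℓ ⊔ suc (o' ⊔ ℓ')) where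
  open Category 𝓑
  infixr 9 _∘'_
  field
    Ob[_]  : Obj → Set o'
    Hom[_] : ∀ {X Y} → Hom X Y → Ob[ X ] → Ob[ Y ] → Set ℓ'

  _≡[_]_ : ∀ {X Y} {f g : Hom X Y} {A : Ob[ X ]} {B : Ob[ Y ]} →
           Hom[ f ] A B → f ≡ g → Hom[ g ] A B → Set ℓ'
  _≡[_]_ {A = A} {B = B} a p b = subst (λ h → Hom[ h ] A B) p a ≡ b

  field
    id'  : ∀ {X} {A : Ob[ X ]} → Hom[ id ] A A
    _∘'_ : ∀ {X Y Z} {g : Hom Y Z} {f : Hom X Y} {A : Ob[ X ]} {B : Ob[ Y ]} {C : Ob[ Z ]} →
           Hom[ g ] B C → Hom[ f ] A B → Hom[ g ∘ f ] A C
    identityˡ' : ∀ {X Y} {f : Hom X Y} {A B} {f' : Hom[ f ] A B} → (id' ∘' f') ≡[ identityˡ ] f'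
    identityʳ' : ∀ {X Y} {f : Hom X Y} {A B} {f' : Hom[ f ] A B} → (f' ∘' id') ≡[ identityʳ ] f'
    assoc' : ∀ {W X Y Z} {f : Hom W X} {g : Hom X Y} {h : Hom Y Z} {A B C D}
             {f' : Hom[ f ] A B} {g' : Hom[ g ] B C} {h' : Hom[ h ] C D} →
             ((h' ∘' g') ∘' f') ≡[ assoc ] (h' ∘' (g' ∘' f'))
    Hom[]-isSet : ∀ {X Y} {f : Hom X Y} {A B} {a b : Hom[ f ] A B} (p q : a ≡ b) → p ≡ q

module _ {o ℓ o' ℓ'} {𝓑 : Category o ℓ} (𝐂 : Displayed 𝓑 o' ℓ') where
  open Category 𝓑
  open Displayed 𝐂

  IsCartesian : ∀ {X Y} {u : Hom X Y} {E' : Ob[ X ]} {E : Ob[ Y ]} → Hom[ u ] E' E → Set (o ⊔ ℓ ⊔ o' ⊔ ℓ')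
  IsCartesian {X = X} {u = u} {E' = E'} {E = E} φ =
    ∀ {W} (v : Hom W X) {E'' : Ob[ W ]} (ψ : Hom[ u ∘ v ] E'' E) →
    Unique (λ (χ : Hom[ v ] E'' E') → φ ∘' χ ≡ ψ)

  IsCocartesian : ∀ {X Y} {u : Hom X Y} {E : Ob[ X ]} {E' : Ob[ Y ]} → Hom[ u ] E E' → Set (o ⊔ ℓ ⊔ o' ⊔ ℓ')
  IsCocartesian {Y = Y} {u = u} {E = E} {E' = E'} ψ =
    ∀ {W} (v : Hom Y W) {E'' : Ob[ W ]} (θ : Hom[ v ∘ u ] E E'') →
    Unique (λ (χ : Hom[ v ] E' E'') → χ ∘' ψ ≡ θ)

  IsFibration : Set (o ⊔ ℓ ⊔ o' ⊔ ℓ')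
  IsFibration = ∀ {X Y} (u : Hom X Y) (E : Ob[ Y ]) →
                Σ Ob[ X ] λ E' → Σ (Hom[ u ] E' E) IsCartesian

  -- c : u*Π → Π (over u) and ε : u*Π → P (over X) form a ∏-diagram over u based on P.
  -- u*p̃ is the (unique, as c is cartesian) vertical χ with c ∘ χ = p̃ ∘ c'.
  IsΠDiagram : ∀ {X Y} (u : Hom X Y) (P : Ob[ X ]) {uΠ : Ob[ X ]} {Π : Ob[ Y ]} →
               Hom[ u ] uΠ Π → Hom[ id ] uΠ P → Set (o ⊔ ℓ ⊔ o' ⊔ ℓ')
  IsΠDiagram {X} {Y} u P {uΠ} {Π} c ε =
    IsCartesian c ×
    (∀ {R : Ob[ Y ]} {uR : Ob[ X ]} (c' : Hom[ u ] uR R) → IsCartesian c' →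
     (p : Hom[ id ] uR P) →
     Unique (λ (p̃ : Hom[ id ] R Π) →
       ∀ (u*p̃ : Hom[ id ] uR uΠ) → (c ∘' u*p̃) ≡[ trans identityʳ (sym identityˡ) ] (p̃ ∘' c') →
       (ε ∘' u*p̃) ≡[ identityˡ ] p))

  record ΠDiagram {X Y} (u : Hom X Y) (P : Ob[ X ]) : Set (o ⊔ ℓ ⊔ o' ⊔ ℓ') where
    field
      Πobj  : Ob[ Y ]
      u*Π   : Ob[ X ]
      c     : Hom[ u ] u*Π Πobj
      ε     : Hom[ id ] u*Π P
      isΠ   : IsΠDiagram u P c ε

  IsPullback : ∀ {A B C D} (f : Hom A B) (h : Hom A C) (k : Hom B D) (g : Hom C D) →
               k ∘ f ≡ g ∘ h → Set (o ⊔ ℓ)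
  IsPullback {B = B} {C = C} f h k g _ =
    ∀ {Z} (a : Hom Z B) (b : Hom Z C) → k ∘ a ≡ g ∘ b →
    Unique (λ (z : Hom Z _) → (f ∘ z ≡ a) × (h ∘ z ≡ b))

  StableΠ : ∀ {B C D} {k : Hom B D} {Q : Ob[ B ]} → ΠDiagram k Q → Hom C D → Set (o ⊔ ℓ ⊔ o' ⊔ ℓ')
  StableΠ {B} {C} {D} {k} {Q} d g =
    ∀ {A} (f : Hom A B) (h : Hom A C) (comm : k ∘ f ≡ g ∘ h) → IsPullback f h k g comm →
    ∀ {fkΠ : Ob[ A ]} (φ₁ : Hom[ f ] fkΠ (ΠDiagram.u*Π d)) → IsCartesian φ₁ →
    ∀ {fQ : Ob[ A ]} (φ₂ : Hom[ f ] fQ Q) → IsCartesian φ₂ →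
    ∀ {gΠ : Ob[ C ]} (φ₃ : Hom[ g ] gΠ (ΠDiagram.Πobj d)) → IsCartesian φ₃ →
    ∀ (m : Hom[ h ] fkΠ gΠ) → (ΠDiagram.c d ∘' φ₁) ≡[ comm ] (φ₃ ∘' m) →
    ∀ (fε : Hom[ id ] fkΠ fQ) → (φ₂ ∘' fε) ≡[ trans identityʳ (sym identityˡ) ] (ΠDiagram.ε d ∘' φ₁) →
    IsΠDiagram h fQ m fε

  StableCocart : ∀ {B C D} {g : Hom C D} {P : Ob[ C ]} {S : Ob[ D ]} → Hom[ g ] P S → Hom B D →
                 Set (o ⊔ ℓ ⊔ o' ⊔ ℓ')
  StableCocart {B} {C} {D} {g} {P} {S} ψ k =
    ∀ {A} (f : Hom A B) (h : Hom A C) (comm : k ∘ f ≡ g ∘ h) → IsPullback f h k g comm →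
    ∀ {hP : Ob[ A ]} (φ₁ : Hom[ h ] hP P) → IsCartesian φ₁ →
    ∀ {kS : Ob[ B ]} (φ₂ : Hom[ k ] kS S) → IsCartesian φ₂ →
    ∀ (n : Hom[ f ] hP kS) → (ψ ∘' φ₁) ≡[ sym comm ] (φ₂ ∘' n) →
    IsCocartesian n

-- Let n : h*P → k*S be the induced map over f. For Q over B the vertical maps k*S → Q
-- correspond, compatibly with precomposition by n, to the maps h*P → Q over f:
--   k*S → Q  ≅  S → ∏_k Q            (∏-diagram over k)
--            ≅  P → ∏_k Q over g     (ψ cocartesian)
--            ≅  P → g*∏_k Q          (cartesian lift)
--            ≅  h*P → f*Q            (the Beck–Chevalley ∏-diagram over h)
--            ≅  h*P → Q over f.
-- Hence n is weakly cocartesian, and in a fibration weakly cocartesian maps are cocartesian.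
module Submission where

open import Defs
open import Data.Product using (Σ; _,_; proj₁; proj₂)
open import Level using (_⊔_)
open import Relation.Binary.PropositionalEquality using (_≡_; refl; sym; trans; subst)

module _ {o ℓ o' ℓ'} {𝓑 : Category o ℓ} (𝐂 : Displayed 𝓑 o' ℓ') where
  open Category 𝓑
  open Displayed 𝐂

  infix 4 _≈_
  _≈_ : ∀ {X Y} {f g : Hom X Y} {A : Ob[ X ]} {B : Ob[ Y ]} → Hom[ f ] A B → Hom[ g ] A B → Set (ℓ ⊔ ℓ')
  _≈_ {f = f} {g} a b = Σ (f ≡ g) (λ p → a ≡[ p ] b)

  module _ {X Y} {A : Ob[ X ]} {B : Ob[ Y ]} where
    ≈-refl : ∀ {f : Hom X Y} {a : Hom[ f ] A B} → a ≈ a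
    ≈-refl = refl , refl

    ≈-sym : ∀ {f g : Hom X Y} {a : Hom[ f ] A B} {b : Hom[ g ] A B} → a ≈ b → b ≈ a
    ≈-sym (refl , refl) = refl , refl

    ≈-trans : ∀ {f g h : Hom X Y} {a : Hom[ f ] A B} {b : Hom[ g ] A B} {c : Hom[ h ] A B} →
              a ≈ b → b ≈ c → a ≈ c
    ≈-trans (refl , refl) (refl , refl) = refl , refl

    ≡⇒≈ : ∀ {f : Hom X Y} {a b : Hom[ f ] A B} → a ≡ b → a ≈ b
    ≡⇒≈ refl = ≈-refl

    ≈⇒≡[] : ∀ {f g : Hom X Y} {a : Hom[ f ] A B} {b : Hom[ g ] A B} → a ≈ b → (p : f ≡ g) → a ≡[ p ] b
    ≈⇒≡[] {a = a} {b = b} (q , e) p = subst (λ r → a ≡[ r ] b) (Hom-isSet q p) e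

    ≈⇒≡ : ∀ {f : Hom X Y} {a b : Hom[ f ] A B} → a ≈ b → a ≡ b
    ≈⇒≡ e = ≈⇒≡[] e refl

    infixl 5 _▷_
    _▷_ : ∀ {f g : Hom X Y} → Hom[ f ] A B → f ≡ g → Hom[ g ] A B
    a ▷ p = subst (λ h → Hom[ h ] A B) p a

    ▷-≈ : ∀ {f g : Hom X Y} {a : Hom[ f ] A B} {p : f ≡ g} → a ▷ p ≈ a
    ▷-≈ {p = refl} = ≈-refl

    infixr 2 _≈⟨_⟩_
    infix 3 _∎
    _≈⟨_⟩_ : ∀ {f g h : Hom X Y} (a : Hom[ f ] A B) {b : Hom[ g ] A B} {c : Hom[ h ] A B} →
              a ≈ b → b ≈ c → a ≈ c
    a ≈⟨ p ⟩ q = ≈-trans p q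

    _∎ : ∀ {f : Hom X Y} (a : Hom[ f ] A B) → a ≈ a
    a ∎ = ≈-refl

  ∘'-cong : ∀ {X Y Z} {g g' : Hom Y Z} {f f' : Hom X Y} {A B C}
            {a : Hom[ g ] B C} {a' : Hom[ g' ] B C} {b : Hom[ f ] A B} {b' : Hom[ f' ] A B} →
            a ≈ a' → b ≈ b' → a ∘' b ≈ a' ∘' b'
  ∘'-cong (refl , refl) (refl , refl) = refl , refl

  ∘'-congˡ : ∀ {X Y Z} {g g' : Hom Y Z} {f : Hom X Y} {A B C}
             {a : Hom[ g ] B C} {a' : Hom[ g' ] B C} {b : Hom[ f ] A B} →
             a ≈ a' → a ∘' b ≈ a' ∘' b
  ∘'-congˡ e = ∘'-cong e ≈-refl

  ∘'-congʳ : ∀ {X Y Z} {g : Hom Y Z} {f f' : Hom X Y} {A B C}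
             {a : Hom[ g ] B C} {b : Hom[ f ] A B} {b' : Hom[ f' ] A B} →
             b ≈ b' → a ∘' b ≈ a ∘' b'
  ∘'-congʳ e = ∘'-cong ≈-refl e

  assoc-≈ : ∀ {W X Y Z} {f : Hom W X} {g : Hom X Y} {h : Hom Y Z} {A B C D}
            {f' : Hom[ f ] A B} {g' : Hom[ g ] B C} {h' : Hom[ h ] C D} →
            (h' ∘' g') ∘' f' ≈ h' ∘' (g' ∘' f')
  assoc-≈ = assoc , assoc'

  pullˡ : ∀ {V W X Z} {e : Hom V W} {b : Hom W X} {a : Hom X Z} {d : Hom W Z} {E₀ E₁ E₂ E₃}
          {e' : Hom[ e ] E₀ E₁} {b' : Hom[ b ] E₁ E₂} {a' : Hom[ a ] E₂ E₃} {d' : Hom[ d ] E₁ E₃} →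
          a' ∘' b' ≈ d' → a' ∘' (b' ∘' e') ≈ d' ∘' e'
  pullˡ ab = ≈-trans (≈-sym assoc-≈) (∘'-congˡ ab)

  pullʳ : ∀ {V W X Z} {e : Hom V W} {b : Hom W X} {a : Hom X Z} {d : Hom V X} {E₀ E₁ E₂ E₃}
          {e' : Hom[ e ] E₀ E₁} {b' : Hom[ b ] E₁ E₂} {a' : Hom[ a ] E₂ E₃} {d' : Hom[ d ] E₀ E₂} →
          b' ∘' e' ≈ d' → (a' ∘' b') ∘' e' ≈ a' ∘' d'
  pullʳ be = ≈-trans assoc-≈ (∘'-congʳ be)

  module Cartesian {X Y} {u : Hom X Y} {E' : Ob[ X ]} {E : Ob[ Y ]}
                   (φ : Hom[ u ] E' E) (φ-cart : IsCartesian 𝐂 φ) where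
    factor : ∀ {W} (v : Hom W X) {E''} {w} (χ : Hom[ w ] E'' E) → w ≡ u ∘ v → Hom[ v ] E'' E'
    factor v χ p = proj₁ (φ-cart v (χ ▷ p))

    factor-eq : ∀ {W} {v : Hom W X} {E''} {w} {χ : Hom[ w ] E'' E} {p : w ≡ u ∘ v} →
                φ ∘' factor v χ p ≈ χ
    factor-eq {v = v} {χ = χ} {p = p} = ≈-trans (≡⇒≈ (proj₁ (proj₂ (φ-cart v (χ ▷ p))))) ▷-≈

    vertical : ∀ {E''} → Hom[ id ∘ u ] E'' E → Hom[ id ] E'' E'
    vertical χ = factor id χ (trans identityˡ (sym identityʳ))

    vertical-eq : ∀ {E''} {χ : Hom[ id ∘ u ] E'' E} → φ ∘' vertical χ ≈ χ
    vertical-eq = factor-eq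

    cancel : ∀ {W} {v v' : Hom W X} {E''} {a : Hom[ v ] E'' E'} {b : Hom[ v' ] E'' E'} →
             v ≡ v' → φ ∘' a ≈ φ ∘' b → a ≈ b
    cancel {v = v} {a = a} {b} refl e =
      ≡⇒≈ (trans (sym (proj₂ (proj₂ U) a refl)) (proj₂ (proj₂ U) b (sym (≈⇒≡ e))))
      where U = φ-cart v (φ ∘' a)

  module Cocartesian {X Y} {u : Hom X Y} {E : Ob[ X ]} {E' : Ob[ Y ]}
                     (ψ : Hom[ u ] E E') (ψ-cocart : IsCocartesian 𝐂 ψ) where
    factor : ∀ {W} (v : Hom Y W) {E''} {w} (θ : Hom[ w ] E E'') → w ≡ v ∘ u → Hom[ v ] E' E''
    factor v θ p = proj₁ (ψ-cocart v (θ ▷ p))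

    factor-eq : ∀ {W} {v : Hom Y W} {E''} {w} {θ : Hom[ w ] E E''} {p : w ≡ v ∘ u} →
                factor v θ p ∘' ψ ≈ θ
    factor-eq {v = v} {θ = θ} {p = p} = ≈-trans (≡⇒≈ (proj₁ (proj₂ (ψ-cocart v (θ ▷ p))))) ▷-≈

    cancel : ∀ {W} {v v' : Hom Y W} {E''} {a : Hom[ v ] E' E''} {b : Hom[ v' ] E' E''} →
             v ≡ v' → a ∘' ψ ≈ b ∘' ψ → a ≈ b
    cancel {v = v} {a = a} {b} refl e =
      ≡⇒≈ (trans (sym (proj₂ (proj₂ U) a refl)) (proj₂ (proj₂ U) b (sym (≈⇒≡ e))))
      where U = ψ-cocart v (a ∘' ψ)

  module ΠUniversal {X Y} {u : Hom X Y} {P : Ob[ X ]} {uΠ : Ob[ X ]} {Π : Ob[ Y ]}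
                    (c : Hom[ u ] uΠ Π) (ε : Hom[ id ] uΠ P) (isΠ : IsΠDiagram 𝐂 u P c ε)
                    {R uR} (c' : Hom[ u ] uR R) (c'-cart : IsCartesian 𝐂 c') (p : Hom[ id ] uR P) where
    private
      U = proj₂ isΠ c' c'-cart p

    IsTranspose : Hom[ id ] R Π → Set (ℓ ⊔ ℓ')
    IsTranspose q = ∀ (w : Hom[ id ] uR uΠ) → c ∘' w ≈ q ∘' c' → ε ∘' w ≈ p

    transpose : Hom[ id ] R Π
    transpose = proj₁ U

    transpose-counit : IsTranspose transpose
    transpose-counit w e = identityˡ , proj₁ (proj₂ U) w (≈⇒≡[] e (trans identityʳ (sym identityˡ)))

    transpose-unique : ∀ q → IsTranspose q → transpose ≡ q
    transpose-unique q q-transpose =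
      proj₂ (proj₂ U) q λ w e → ≈⇒≡[] (q-transpose w (_ , e)) identityˡ

  IsWeaklyCocartesian : ∀ {X Y} {f : Hom X Y} {E : Ob[ X ]} {E' : Ob[ Y ]} →
                        Hom[ f ] E E' → Set (o' ⊔ ℓ ⊔ ℓ')
  IsWeaklyCocartesian {Y = Y} {f = f} {E} {E'} n =
    ∀ (Q : Ob[ Y ]) (θ : Hom[ f ] E Q) → Unique (λ (χ : Hom[ id ] E' Q) → χ ∘' n ≈ θ)

  -- A map over v ∘ f is factored through the cartesian lift of v, reducing to the vertical case.
  weaklyCocartesian⇒cocartesian : IsFibration 𝐂 →
    ∀ {X Y} {f : Hom X Y} {E : Ob[ X ]} {E' : Ob[ Y ]} (n : Hom[ f ] E E') →
    IsWeaklyCocartesian n → IsCocartesian 𝐂 n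
  weaklyCocartesian⇒cocartesian fib {Y = Y} {f = f} {E} {E'} n n-weak v {E''} θ = χ , χ-factors , χ-unique
    where
    v*E'' : Ob[ Y ]
    v*E'' = proj₁ (fib v E'')

    ρ : Hom[ v ] v*E'' E''
    ρ = proj₁ (proj₂ (fib v E''))

    module R = Cartesian ρ (proj₂ (proj₂ (fib v E'')))

    θ' : Hom[ f ] E v*E''
    θ' = R.factor f θ refl

    U : Unique (λ (χ' : Hom[ id ] E' v*E'') → χ' ∘' n ≈ θ')
    U = n-weak v*E'' θ'

    χ' : Hom[ id ] E' v*E''
    χ' = proj₁ U

    χ : Hom[ v ] E' E''
    χ = (ρ ∘' χ') ▷ identityʳ

    χ-factors : χ ∘' n ≡ θ
    χ-factors = ≈⇒≡ (
      χ ∘' n          ≈⟨ ∘'-congˡ ▷-≈ ⟩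
      (ρ ∘' χ') ∘' n  ≈⟨ pullʳ (proj₁ (proj₂ U)) ⟩
      ρ ∘' θ'         ≈⟨ R.factor-eq ⟩
      θ               ∎)

    χ-unique : ∀ (y : Hom[ v ] E' E'') → y ∘' n ≡ θ → χ ≡ y
    χ-unique y yn = ≈⇒≡ (
      χ         ≈⟨ ▷-≈ ⟩
      ρ ∘' χ'   ≈⟨ ∘'-congʳ (≡⇒≈ (proj₂ (proj₂ U) y' y'n)) ⟩
      ρ ∘' y'   ≈⟨ R.factor-eq ⟩
      y         ∎)
      where
      y' : Hom[ id ] E' v*E''
      y' = R.factor id y (sym identityʳ)

      y'n : y' ∘' n ≈ θ'
      y'n = R.cancel identityˡ (
        ρ ∘' (y' ∘' n)  ≈⟨ pullˡ R.factor-eq ⟩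
        y ∘' n          ≈⟨ ≡⇒≈ yn ⟩
        θ               ≈⟨ ≈-sym R.factor-eq ⟩
        ρ ∘' θ'         ∎)

  module BeckChevalleyTranspose
    (fib : IsFibration 𝐂)
    {A B C D} {f : Hom A B} {h : Hom A C} {k : Hom B D} {g : Hom C D}
    (comm : k ∘ f ≡ g ∘ h) (pb : IsPullback 𝐂 f h k g comm)
    {P S} (ψ : Hom[ g ] P S) (ψ-cocart : IsCocartesian 𝐂 ψ)
    {hP} (φP : Hom[ h ] hP P) (φP-cart : IsCartesian 𝐂 φP)
    {kS} (φS : Hom[ k ] kS S) (φS-cart : IsCartesian 𝐂 φS)
    (n : Hom[ f ] hP kS) (n-square : ψ ∘' φP ≈ φS ∘' n)
    {Q} (d : ΠDiagram 𝐂 k Q) (d-stable : StableΠ 𝐂 d g)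
    where
    open ΠDiagram d

    fkΠ : Ob[ A ]
    fkΠ = proj₁ (fib f u*Π)

    φkΠ : Hom[ f ] fkΠ u*Π
    φkΠ = proj₁ (proj₂ (fib f u*Π))

    φkΠ-cart : IsCartesian 𝐂 φkΠ
    φkΠ-cart = proj₂ (proj₂ (fib f u*Π))

    fQ : Ob[ A ]
    fQ = proj₁ (fib f Q)

    φQ : Hom[ f ] fQ Q
    φQ = proj₁ (proj₂ (fib f Q))

    φQ-cart : IsCartesian 𝐂 φQ
    φQ-cart = proj₂ (proj₂ (fib f Q))

    gΠ : Ob[ C ]
    gΠ = proj₁ (fib g Πobj)

    φΠ : Hom[ g ] gΠ Πobj
    φΠ = proj₁ (proj₂ (fib g Πobj))

    φΠ-cart : IsCartesian 𝐂 φΠ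
    φΠ-cart = proj₂ (proj₂ (fib g Πobj))

    module Ψ   = Cocartesian ψ ψ-cocart
    module Πk  = Cartesian c (proj₁ isΠ)
    module FkΠ = Cartesian φkΠ φkΠ-cart
    module FQ  = Cartesian φQ φQ-cart
    module GΠ  = Cartesian φΠ φΠ-cart

    m : Hom[ h ] fkΠ gΠ
    m = GΠ.factor h (c ∘' φkΠ) comm

    fε : Hom[ id ] fkΠ fQ
    fε = FQ.vertical (ε ∘' φkΠ)

    isΠ-h : IsΠDiagram 𝐂 h fQ m fε
    isΠ-h = d-stable f h comm pb φkΠ φkΠ-cart φQ φQ-cart φΠ φΠ-cart
      m (≈⇒≡[] (≈-sym GΠ.factor-eq) comm) fε (≈⇒≡[] FQ.factor-eq (trans identityʳ (sym identityˡ)))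

    -- Transposing along m (over h) and along φkΠ (over f) agree on maps coming from a ∘ ψ = φΠ ∘ b.
    module Compatible (a : Hom[ id ] S Πobj) (b : Hom[ id ] P gΠ) (ab : φΠ ∘' b ≈ a ∘' ψ) where
      k*a : Hom[ id ] kS u*Π
      k*a = Πk.vertical (a ∘' φS)

      boundary : φΠ ∘' (b ∘' φP) ≈ c ∘' (k*a ∘' n)
      boundary =
        φΠ ∘' (b ∘' φP)   ≈⟨ pullˡ ab ⟩
        (a ∘' ψ) ∘' φP    ≈⟨ pullʳ n-square ⟩
        a ∘' (φS ∘' n)    ≈⟨ pullˡ (≈-sym Πk.factor-eq) ⟩
        (c ∘' k*a) ∘' n   ≈⟨ assoc-≈ ⟩
        c ∘' (k*a ∘' n)   ∎

      over-h⇒over-f : ∀ (w : Hom[ id ] hP fkΠ) → m ∘' w ≈ b ∘' φP → φkΠ ∘' w ≈ k*a ∘' n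
      over-h⇒over-f w e = Πk.cancel (trans identityʳ (sym identityˡ)) (
        c ∘' (φkΠ ∘' w)  ≈⟨ pullˡ (≈-sym GΠ.factor-eq) ⟩
        (φΠ ∘' m) ∘' w   ≈⟨ pullʳ e ⟩
        φΠ ∘' (b ∘' φP)  ≈⟨ boundary ⟩
        c ∘' (k*a ∘' n)  ∎)

      over-f⇒over-h : ∀ (w : Hom[ id ] hP fkΠ) → φkΠ ∘' w ≈ k*a ∘' n → m ∘' w ≈ b ∘' φP
      over-f⇒over-h w e = GΠ.cancel (trans identityʳ (sym identityˡ)) (
        φΠ ∘' (m ∘' w)   ≈⟨ pullˡ GΠ.factor-eq ⟩
        (c ∘' φkΠ) ∘' w  ≈⟨ pullʳ e ⟩
        c ∘' (k*a ∘' n)  ≈⟨ ≈-sym boundary ⟩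
        φΠ ∘' (b ∘' φP)  ∎)

    module _ (θ : Hom[ f ] hP Q) where
      θ♭ : Hom[ id ] hP fQ
      θ♭ = FQ.factor id θ (sym identityʳ)

      module Πh = ΠUniversal m fε isΠ-h φP φP-cart θ♭

      σ : Hom[ id ] S Πobj
      σ = Ψ.factor id (φΠ ∘' Πh.transpose) (trans identityʳ (sym identityˡ))

      open Compatible σ Πh.transpose (≈-sym Ψ.factor-eq)

      n-factor : Hom[ id ] kS Q
      n-factor = (ε ∘' k*a) ▷ identityˡ

      n-factor-eq : n-factor ∘' n ≈ θ
      n-factor-eq =
        n-factor ∘' n      ≈⟨ ∘'-congˡ ▷-≈ ⟩
        (ε ∘' k*a) ∘' n    ≈⟨ pullʳ (≈-sym FkΠ.factor-eq) ⟩
        ε ∘' (φkΠ ∘' t)    ≈⟨ pullˡ (≈-sym FQ.factor-eq) ⟩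
        (φQ ∘' fε) ∘' t    ≈⟨ pullʳ (Πh.transpose-counit t (over-f⇒over-h t FkΠ.factor-eq)) ⟩
        φQ ∘' θ♭           ≈⟨ FQ.factor-eq ⟩
        θ                  ∎
        where
        t : Hom[ id ] hP fkΠ
        t = FkΠ.vertical (k*a ∘' n)

      n-factor-unique : ∀ (y : Hom[ id ] kS Q) → y ∘' n ≈ θ → n-factor ≡ y
      n-factor-unique y yn = ≈⇒≡ (
        n-factor    ≈⟨ ▷-≈ ⟩
        ε ∘' k*a    ≈⟨ Πy.transpose-counit k*a (≈-trans Πk.factor-eq (∘'-congˡ σ≈τ)) ⟩
        y           ∎)
        where
        module Πy = ΠUniversal c ε isΠ φS φS-cart y

        τ : Hom[ id ] S Πobj
        τ = Πy.transpose

        q : Hom[ id ] P gΠ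
        q = GΠ.vertical (τ ∘' ψ)

        module τ-compat = Compatible τ q GΠ.vertical-eq

        q-transpose : Πh.IsTranspose q
        q-transpose w e = FQ.cancel identityˡ (
          φQ ∘' (fε ∘' w)              ≈⟨ pullˡ FQ.factor-eq ⟩
          (ε ∘' φkΠ) ∘' w              ≈⟨ pullʳ (τ-compat.over-h⇒over-f w e) ⟩
          ε ∘' (τ-compat.k*a ∘' n)     ≈⟨ pullˡ (Πy.transpose-counit τ-compat.k*a Πk.factor-eq) ⟩
          y ∘' n                       ≈⟨ yn ⟩
          θ                            ≈⟨ ≈-sym FQ.factor-eq ⟩
          φQ ∘' θ♭                     ∎)

        σ≈τ : σ ≈ τ
        σ≈τ = Ψ.cancel refl (
          σ ∘' ψ                 ≈⟨ Ψ.factor-eq ⟩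
          φΠ ∘' Πh.transpose     ≈⟨ ∘'-congʳ (≡⇒≈ (Πh.transpose-unique q q-transpose)) ⟩
          φΠ ∘' q                ≈⟨ GΠ.vertical-eq ⟩
          τ ∘' ψ                 ∎)

      n-factorisation : Unique (λ (χ : Hom[ id ] kS Q) → χ ∘' n ≈ θ)
      n-factorisation = n-factor , n-factor-eq , n-factor-unique

proposition3p1p10 : ∀ {o ℓ o' ℓ'} {𝓑 : Category o ℓ} (𝐂 : Displayed 𝓑 o' ℓ') →
    IsFibration 𝐂 →
    ∀ {B C D : Category.Obj 𝓑} (g : Category.Hom 𝓑 C D) (k : Category.Hom 𝓑 B D) →
    (∀ (Q : Displayed.Ob[_] 𝐂 B) → Σ (ΠDiagram 𝐂 k Q) (λ d → StableΠ 𝐂 d g)) →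
    ∀ {P : Displayed.Ob[_] 𝐂 C} {S : Displayed.Ob[_] 𝐂 D} (ψ : Displayed.Hom[_] 𝐂 g P S) →
    IsCocartesian 𝐂 ψ → StableCocart 𝐂 ψ k
proposition3p1p10 𝐂 fib g k stableΠ ψ ψ-cocart f h comm pb φP φP-cart φS φS-cart n n-square =
  weaklyCocartesian⇒cocartesian 𝐂 fib n λ Q →
    BeckChevalleyTranspose.n-factorisation 𝐂 fib comm pb ψ ψ-cocart φP φP-cart φS φS-cart
      n (sym comm , n-square) (proj₁ (stableΠ Q)) (proj₂ (stableΠ Q))
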